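{- Let $\ell\ge 1$ and let $A=(a_1,\ldots,a_\ell)$ and $B=(b_1,\ldots,b_\ell)$ be two words in $\{\mathrm{H},\mathrm{T}\}^\ell$ such that $\mathrm{Cor}(A,A)=\mathrm{Cor}(B,B)$ (equivalently $[A,A]=[B,B]$). For $n\ge 1$, let $X_n=(\varepsilon_1,\ldots,\varepsilon_n)$ where, under $\mathbb{P}_n$, the letters $\varepsilon_i$ are i.i.d. uniformly distributed on $\{\mathrm{H},\mathrm{T}\}$. Then for every $n\ge 1$, the random pairs $(N_A(X_n),N_B(X_n))$ and $(N_B(X_n),N_A(X_n))$ have the same distribution. In particular, for every $n\ge1$, $$\mathbb{P}_n\big(N_B(X_n)>N_A(X_n)\big)=\mathbb{P}_n\big(N_A(X_n)>N_B(X_n)\big).$$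
   Context: A word of length $\ell$ is a sequence in $\{\mathrm{H},\mathrm{T}\}^\ell$. For a word $A=(a_1,\ldots,a_\ell)$ and a sequence $X_n=(\varepsilon_k)_{1\le k\le n}\in\{\mathrm{H},\mathrm{T}\}^n$, the number of (possibly overlapping) occurrences of $A$ in $X_n$ is $N_A(X_n)=|\{\ell\le k\le n:\ (\varepsilon_{k-\ell+1},\ldots,\varepsilon_k)=(a_1,\ldots,a_\ell)\}|$. For two words $A,B$ of length $\ell$, $\mathrm{Cor}(A,B)=\{1\le k\le \ell-1:\ (a_{\ell-k+1},\ldots,a_\ell)=(b_1,\ldots,b_k)\}$ and $[A,B]=\sum_{k\in\mathrm{Cor}(A,B)}2^k$; $[A,A]$ is the auto-correlation of $A$. -}

module Defs where

open import Data.Nat using (ℕ; zero; suc; _∸_; _≤_; _≤?_)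
open import Data.Nat.Properties using (_≟_)
open import Data.List using (List; []; _∷_; length; filter; upTo; take; drop; map; concatMap; _++_)
open import Data.List.Properties using (≡-dec)
open import Data.Vec using (Vec; []; _∷_; toList)
open import Data.Product using (_×_; _,_)
open import Relation.Nullary using (Dec; yes; no; _×-dec_)
open import Relation.Binary.PropositionalEquality using (_≡_; refl)

data Letter : Set where
  H T : Letter

_≟L_ : (x y : Letter) → Dec (x ≡ y)
H ≟L H = yes refl
H ≟L T = no λ ()
T ≟L H = no λ ()
T ≟L T = yes refl

Word : ℕ → Set
Word ℓ = Vec Letter ℓ

-- Window ending at (1-based) position k: (ε_{k-ℓ+1},…,ε_k)
window : ℕ → ℕ → List Letter → List Letter
window ℓ k xs = take ℓ (drop (k ∸ ℓ) xs)

N : ∀ {ℓ n} → Word ℓ → Vec Letter n → ℕ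
N {ℓ} {n} A X =
  length (filter (λ k → (ℓ ≤? k) ×-dec ≡-dec _≟L_ (window ℓ k (toList X)) (toList A))
                 (upTo (suc n)))

Cor : ∀ {ℓ} → Word ℓ → Word ℓ → ℕ → Set
Cor {ℓ} A B k = (1 ≤ k) × (k ≤ ℓ ∸ 1) × (drop (ℓ ∸ k) (toList A) ≡ take k (toList B))

-- All 2^n sequences in {H,T}^n (the sample space of P_n, uniform measure)
allSeqs : (n : ℕ) → List (Vec Letter n)
allSeqs zero = [] ∷ []
allSeqs (suc n) = map (H ∷_) (allSeqs n) ++ map (T ∷_) (allSeqs n)

-- number of sequences X in {H,T}^n with (N_A X, N_B X) = (i , j);
-- P_n((N_A,N_B) = (i,j)) = this / 2^n
countPair : ∀ {ℓ} (n : ℕ) → Word ℓ → Word ℓ → ℕ → ℕ → ℕ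
countPair n A B i j = length (filter (λ X → (N A X ≟ i) ×-dec (N B X ≟ j)) (allSeqs n))

-- number of sequences X in {H,T}^n with N_B X > N_A X;
-- P_n(N_B > N_A) = this / 2^n
countGreater : ∀ {ℓ} (n : ℕ) → Word ℓ → Word ℓ → ℕ
countGreater n A B = length (filter (λ X → suc (N A X) ≤? N B X) (allSeqs n))

-- Give a sequence X the weight (1 + a)^(N_A X) (1 + b)^(N_B X). Removing the first letter and
-- telescoping along the overlaps of A and B (as in Guibas and Odlyzko) shows that the total weight f of
-- the sequences of length n, together with the weights G_A, G_B of the sequences beginning with A or B,
-- solve a linear recurrence whose coefficients are the correlations of A and B. Exchanging A and B
-- transposes the cross-correlations and, because Cor(A,A) = Cor(B,B), keeps the autocorrelations; for
-- two such transposed systems the identity f ⋆ (a G'_A + b G'_B) = f' ⋆ (a G_A + b G_B) forces f = f'.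
-- So the total weight is unchanged when N_A and N_B are exchanged. For a = 2^n and 1 + b = (2^n + 1)^(n+1)
-- the weight of X is M^(N_A X + (n+1) N_B X) with M = 2^n + 1 exceeding the number of sequences, so the
-- total weight determines, digit by digit in base M, how many sequences realise each pair (N_A, N_B).

module Submission where

open import Data.Bool using (Bool; true; false; if_then_else_)
open import Data.List using (List; []; _∷_; _++_; map; length; take; drop; filter; applyUpTo; upTo)
open import Data.List.Properties
  using (≡-dec; length-map; length-take; length-drop; take++drop≡id; drop-drop; drop-all; ++-assoc)
open import Data.Nat using (ℕ; zero; suc; _+_; _*_; _∸_; _^_; _⊓_; _≤_; _<_; z≤n; s≤s; s≤s⁻¹; _≤?_)
open import Data.Nat.Divisibility using (divides)
open import Data.Nat.DivMod using (_%_; _/_; [m+kn]%n≡m%n; m<n⇒m%n≡m; m<n⇒m/n≡0; m*n/n≡m; +-distrib-/-∣ʳ)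
open import Data.Nat.Properties
open import Data.Nat.Tactic.RingSolver using (solve-∀)
open import Data.Product using (_×_; _,_; proj₁; proj₂)
open import Data.Sum using (_⊎_; inj₁; inj₂)
open import Data.Vec using (Vec; toList) renaming (_∷_ to _∷ᵥ_)
import Data.Vec.Properties as Vec
open import Function.Bundles using (_⇔_; mk⇔; Equivalence)
open import Function.Construct.Composition using (_⇔-∘_)
open import Function.Construct.Symmetry using (⇔-sym)
open import Relation.Binary using (tri<; tri≈; tri>)
open import Relation.Binary.PropositionalEquality using (_≡_; _≢_; refl; sym; trans; cong; cong₂; module ≡-Reasoning)
open import Relation.Nullary using (Dec; yes; no; does; _×-dec_; contradiction)
open import Relation.Nullary.Decidable using (dec-true; dec-false)
import Algebra.Properties.CommutativeSemigroup +-commutativeSemigroup as +-CS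
import Algebra.Properties.CommutativeSemigroup *-commutativeSemigroup as *-CS

open import Defs

-- Finite sums

∑ : {A : Set} → List A → (A → ℕ) → ℕ
∑ [] g = 0
∑ (x ∷ xs) g = g x + ∑ xs g

∑< : ℕ → (ℕ → ℕ) → ℕ
∑< zero g = 0
∑< (suc n) g = g 0 + ∑< n (λ j → g (suc j))

∑₂ : (Bool → ℕ) → ℕ
∑₂ g = g true + g false

module _ {A : Set} where

  ∑-cong : ∀ (xs : List A) {g h} → (∀ x → g x ≡ h x) → ∑ xs g ≡ ∑ xs h
  ∑-cong [] e = refl
  ∑-cong (x ∷ xs) e = cong₂ _+_ (e x) (∑-cong xs e)

  ∑-zero : ∀ (xs : List A) → ∑ xs (λ _ → 0) ≡ 0
  ∑-zero [] = refl
  ∑-zero (x ∷ xs) = ∑-zero xs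

  ∑-+ : ∀ (xs : List A) g h → ∑ xs (λ x → g x + h x) ≡ ∑ xs g + ∑ xs h
  ∑-+ [] g h = refl
  ∑-+ (x ∷ xs) g h = trans (cong (g x + h x +_) (∑-+ xs g h)) (+-CS.interchange (g x) (h x) _ _)

  ∑-* : ∀ (xs : List A) k g → ∑ xs (λ x → k * g x) ≡ k * ∑ xs g
  ∑-* [] k g = sym (*-zeroʳ k)
  ∑-* (x ∷ xs) k g = trans (cong (k * g x +_) (∑-* xs k g)) (sym (*-distribˡ-+ k (g x) _))

  ∑-++ : ∀ (xs ys : List A) g → ∑ (xs ++ ys) g ≡ ∑ xs g + ∑ ys g
  ∑-++ [] ys g = refl
  ∑-++ (x ∷ xs) ys g = trans (cong (g x +_) (∑-++ xs ys g)) (sym (+-assoc (g x) _ _))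

∑-map : ∀ {A B : Set} (xs : List A) (h : A → B) g → ∑ (map h xs) g ≡ ∑ xs (λ x → g (h x))
∑-map [] h g = refl
∑-map (x ∷ xs) h g = cong (g (h x) +_) (∑-map xs h g)

∑<-cong : ∀ n {g h : ℕ → ℕ} → (∀ j → j < n → g j ≡ h j) → ∑< n g ≡ ∑< n h
∑<-cong zero e = refl
∑<-cong (suc n) e = cong₂ _+_ (e 0 (s≤s z≤n)) (∑<-cong n (λ j j<n → e (suc j) (s≤s j<n)))

∑<-zero : ∀ n → ∑< n (λ _ → 0) ≡ 0
∑<-zero zero = refl
∑<-zero (suc n) = ∑<-zero n

∑<-+ : ∀ n (g h : ℕ → ℕ) → ∑< n (λ j → g j + h j) ≡ ∑< n g + ∑< n h
∑<-+ zero g h = refl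
∑<-+ (suc n) g h =
  trans (cong (g 0 + h 0 +_) (∑<-+ n (λ j → g (suc j)) (λ j → h (suc j)))) (+-CS.interchange (g 0) (h 0) _ _)

∑<-* : ∀ n k (g : ℕ → ℕ) → ∑< n (λ j → k * g j) ≡ k * ∑< n g
∑<-* zero k g = sym (*-zeroʳ k)
∑<-* (suc n) k g = trans (cong (k * g 0 +_) (∑<-* n k (λ j → g (suc j)))) (sym (*-distribˡ-+ k (g 0) _))

∑-∑< : ∀ {A : Set} (xs : List A) n (F : A → ℕ → ℕ) → ∑ xs (λ x → ∑< n (F x)) ≡ ∑< n (λ j → ∑ xs (λ x → F x j))
∑-∑< xs zero F = ∑-zero xs
∑-∑< xs (suc n) F = trans (∑-+ xs _ _) (cong (∑ xs (λ x → F x 0) +_) (∑-∑< xs n (λ x j → F x (suc j))))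

∑<-∑₂ : ∀ n (F : Bool → ℕ → ℕ) → ∑< n (λ j → ∑₂ (λ x → F x j)) ≡ ∑₂ (λ x → ∑< n (F x))
∑<-∑₂ n F = ∑<-+ n (F true) (F false)

𝟙 : ∀ {p} {P : Set p} → Dec P → ℕ
𝟙 P? = if does P? then 1 else 0

δ : ℕ → ℕ → ℕ
δ m n = 𝟙 (m ≟ n)

length-filter-∑ : ∀ {A : Set} {P : A → Set} (P? : ∀ x → Dec (P x)) xs → length (filter P? xs) ≡ ∑ xs (λ x → 𝟙 (P? x))
length-filter-∑ P? [] = refl
length-filter-∑ P? (x ∷ xs) with does (P? x)
... | true = cong suc (length-filter-∑ P? xs)
... | false = length-filter-∑ P? xs

∑-applyUpTo : ∀ m (g h : ℕ → ℕ) → ∑ (applyUpTo g m) h ≡ ∑< m (λ k → h (g k))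
∑-applyUpTo zero g h = refl
∑-applyUpTo (suc m) g h = cong (h (g 0) +_) (∑-applyUpTo m (λ k → g (suc k)) h)

∑<-δ : ∀ m t (g : ℕ → ℕ) → t < m → ∑< m (λ k → δ t k * g k) ≡ g t
∑<-δ (suc m) zero g _ = trans (cong (g 0 + 0 +_) (∑<-zero m)) (trans (+-identityʳ _) (+-identityʳ (g 0)))
∑<-δ (suc m) (suc t) g (s≤s t<m) = ∑<-δ m t (λ k → g (suc k)) t<m

∑<-δ-beyond : ∀ m t (g : ℕ → ℕ) → m ≤ t → ∑< m (λ k → δ t k * g k) ≡ 0
∑<-δ-beyond zero t g _ = refl
∑<-δ-beyond (suc m) (suc t) g (s≤s m≤t) = ∑<-δ-beyond m t (λ k → g (suc k)) m≤t

-- Base-M digits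

count : ℕ → List ℕ → ℕ
count v xs = ∑ xs (λ x → δ x v)

decrement : List ℕ → List ℕ
decrement [] = []
decrement (zero ∷ xs) = decrement xs
decrement (suc x ∷ xs) = x ∷ decrement xs

count-suc : ∀ v xs → count (suc v) xs ≡ count v (decrement xs)
count-suc v [] = refl
count-suc v (zero ∷ xs) = count-suc v xs
count-suc v (suc x ∷ xs) = cong (δ x v +_) (count-suc v xs)

count-≤-length : ∀ v xs → count v xs ≤ length xs
count-≤-length v [] = z≤n
count-≤-length v (x ∷ xs) with does (x ≟ v)
... | true = s≤s (count-≤-length v xs)
... | false = m≤n⇒m≤1+n (count-≤-length v xs)

length-decrement : ∀ xs → length (decrement xs) ≤ length xs
length-decrement [] = z≤n
length-decrement (zero ∷ xs) = m≤n⇒m≤1+n (length-decrement xs)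
length-decrement (suc x ∷ xs) = s≤s (length-decrement xs)

module _ (m : ℕ) where

  power-sum : List ℕ → ℕ
  power-sum xs = ∑ xs (suc m ^_)

  power-sum-digit : ∀ xs → power-sum xs ≡ count 0 xs + suc m * power-sum (decrement xs)
  power-sum-digit [] = sym (*-zeroʳ (suc m))
  power-sum-digit (zero ∷ xs) = cong suc (power-sum-digit xs)
  power-sum-digit (suc x ∷ xs) = trans (cong (suc m ^ suc x +_) (power-sum-digit xs))
    (trans (+-CS.x∙yz≈y∙xz (suc m ^ suc x) (count 0 xs) _) (cong (count 0 xs +_) (sym (*-distribˡ-+ (suc m) (suc m ^ x) (power-sum (decrement xs))))))

  last-digit-unique : ∀ z₁ z₂ s₁ s₂ → z₁ ≤ m → z₂ ≤ m → z₁ + suc m * s₁ ≡ z₂ + suc m * s₂ → z₁ ≡ z₂ × s₁ ≡ s₂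
  last-digit-unique z₁ z₂ s₁ s₂ z₁≤m z₂≤m e = z₁≡z₂ , *-cancelˡ-≡ s₁ s₂ (suc m) (+-cancelˡ-≡ z₁ _ _ (trans e (cong (_+ suc m * s₂) (sym z₁≡z₂))))
    where
    remainder : ∀ z s → z ≤ m → (z + suc m * s) % suc m ≡ z
    remainder z s z≤m = trans (cong (λ t → (z + t) % suc m) (*-comm (suc m) s)) (trans ([m+kn]%n≡m%n z s (suc m)) (m<n⇒m%n≡m (s≤s z≤m)))
    z₁≡z₂ : z₁ ≡ z₂
    z₁≡z₂ = trans (sym (remainder z₁ s₁ z₁≤m)) (trans (cong (_% suc m) e) (remainder z₂ s₂ z₂≤m))

  count-determined : ∀ v xs ys → length xs ≤ m → length ys ≤ m → power-sum xs ≡ power-sum ys → count v xs ≡ count v ys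
  count-determined v xs ys |xs|≤m |ys|≤m e with last-digit-unique (count 0 xs) (count 0 ys) _ _
      (≤-trans (count-≤-length 0 xs) |xs|≤m) (≤-trans (count-≤-length 0 ys) |ys|≤m)
      (trans (sym (power-sum-digit xs)) (trans e (power-sum-digit ys)))
  count-determined zero xs ys _ _ _ | zeros , _ = zeros
  count-determined (suc v) xs ys |xs|≤m |ys|≤m _ | _ , rest = begin
    count (suc v) xs          ≡⟨ count-suc v xs ⟩
    count v (decrement xs)    ≡⟨ count-determined v (decrement xs) (decrement ys)
                                   (≤-trans (length-decrement xs) |xs|≤m) (≤-trans (length-decrement ys) |ys|≤m) rest ⟩
    count v (decrement ys)    ≡⟨ count-suc v ys ⟨
    count (suc v) ys          ∎
    where open ≡-Reasoning

∑-by-count : ∀ {A : Set} (L : List A) (d : A → ℕ) B → (∀ a → d a < B) → (φ : ℕ → ℕ) →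
  ∑ L (λ a → φ (d a)) ≡ ∑< B (λ v → φ v * count v (map d L))
∑-by-count L d B d<B φ = begin
    ∑ L (λ a → φ (d a))
  ≡⟨ ∑-cong L (λ a → sym (∑<-δ B (d a) φ (d<B a))) ⟩
    ∑ L (λ a → ∑< B (λ v → δ (d a) v * φ v))
  ≡⟨ ∑-∑< L B _ ⟩
    ∑< B (λ v → ∑ L (λ a → δ (d a) v * φ v))
  ≡⟨ ∑<-cong B (λ v _ → trans (∑-cong L (λ a → *-comm (δ (d a) v) (φ v)))
                              (trans (∑-* L (φ v) _) (cong (φ v *_) (sym (∑-map L d (λ x → δ x v)))))) ⟩
    ∑< B (λ v → φ v * count v (map d L))
  ∎
  where open ≡-Reasoning

power-sums-determine-sums : ∀ {A : Set} (L : List A) (d₁ d₂ : A → ℕ) m B → length L ≤ m →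
  (∀ a → d₁ a < B) → (∀ a → d₂ a < B) → ∑ L (λ a → suc m ^ d₁ a) ≡ ∑ L (λ a → suc m ^ d₂ a) →
  ∀ φ → ∑ L (λ a → φ (d₁ a)) ≡ ∑ L (λ a → φ (d₂ a))
power-sums-determine-sums L d₁ d₂ m B |L|≤m d₁<B d₂<B e φ = begin
    ∑ L (λ a → φ (d₁ a))                      ≡⟨ ∑-by-count L d₁ B d₁<B φ ⟩
    ∑< B (λ v → φ v * count v (map d₁ L))     ≡⟨ ∑<-cong B (λ v _ → cong (φ v *_) (same-counts v)) ⟩
    ∑< B (λ v → φ v * count v (map d₂ L))     ≡⟨ ∑-by-count L d₂ B d₂<B φ ⟨
    ∑ L (λ a → φ (d₂ a))                      ∎
  where
  open ≡-Reasoning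
  |map|≤m : ∀ d → length (map d L) ≤ m
  |map|≤m d = ≤-trans (≤-reflexive (length-map d L)) |L|≤m
  same-counts : ∀ v → count v (map d₁ L) ≡ count v (map d₂ L)
  same-counts v = count-determined m v (map d₁ L) (map d₂ L) (|map|≤m d₁) (|map|≤m d₂)
    (trans (∑-map L d₁ _) (trans e (sym (∑-map L d₂ _))))

-- Coefficient sequences of power series in z: shift j multiplies by z^j and _⋆_ is the Cauchy product.
Series : Set
Series = ℕ → ℕ

tail : Series → Series
tail s i = s (suc i)

shift : ℕ → Series → Series
shift zero s m = s m
shift (suc j) s zero = 0
shift (suc j) s (suc m) = shift j s m

infixl 7 _⋆_

_⋆_ : Series → Series → Series
(c ⋆ f) zero = c 0 * f 0
(c ⋆ f) (suc m) = c 0 * f (suc m) + (tail c ⋆ f) m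

shift-cong-≤ : ∀ j m {s s' : Series} → (∀ i → i ≤ m → s i ≡ s' i) → shift j s m ≡ shift j s' m
shift-cong-≤ zero m e = e m ≤-refl
shift-cong-≤ (suc j) zero e = refl
shift-cong-≤ (suc j) (suc m) e = shift-cong-≤ j m (λ i i≤m → e i (m≤n⇒m≤1+n i≤m))

shift-linear : ∀ j m (s t : Series) a b → shift j (λ i → a * s i + b * t i) m ≡ a * shift j s m + b * shift j t m
shift-linear zero m s t a b = refl
shift-linear (suc j) zero s t a b = sym (cong₂ _+_ (*-zeroʳ a) (*-zeroʳ b))
shift-linear (suc j) (suc m) s t a b = shift-linear j m s t a b

⋆-cong-≤ : ∀ m {c c' f f' : Series} → (∀ i → i ≤ m → c i ≡ c' i) → (∀ i → i ≤ m → f i ≡ f' i) →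
  (c ⋆ f) m ≡ (c' ⋆ f') m
⋆-cong-≤ zero ec ef = cong₂ _*_ (ec 0 z≤n) (ef 0 z≤n)
⋆-cong-≤ (suc m) ec ef = cong₂ _+_ (cong₂ _*_ (ec 0 z≤n) (ef (suc m) ≤-refl))
  (⋆-cong-≤ m (λ i i≤m → ec (suc i) (s≤s i≤m)) (λ i i≤m → ef i (m≤n⇒m≤1+n i≤m)))

⋆-cong : ∀ m {c c' f f' : Series} → (∀ i → c i ≡ c' i) → (∀ i → f i ≡ f' i) → (c ⋆ f) m ≡ (c' ⋆ f') m
⋆-cong m ec ef = ⋆-cong-≤ m (λ i _ → ec i) (λ i _ → ef i)

⋆-suc : ∀ m (c f : Series) → (c ⋆ f) (suc m) ≡ c (suc m) * f 0 + (c ⋆ tail f) m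
⋆-suc zero c f = +-comm (c 0 * f 1) (c 1 * f 0)
⋆-suc (suc m) c f = trans (cong (c 0 * f (suc (suc m)) +_) (⋆-suc m (tail c) f))
  (+-CS.x∙yz≈y∙xz (c 0 * f (suc (suc m))) (c (suc (suc m)) * f 0) _)

⋆-comm : ∀ m (c f : Series) → (c ⋆ f) m ≡ (f ⋆ c) m
⋆-comm zero c f = *-comm (c 0) (f 0)
⋆-comm (suc m) c f = trans (cong₂ _+_ (*-comm (c 0) (f (suc m))) (⋆-comm m (tail c) f)) (sym (⋆-suc m f c))

⋆-zeroʳ : ∀ m (c : Series) → (c ⋆ (λ _ → 0)) m ≡ 0
⋆-zeroʳ zero c = *-zeroʳ (c 0)
⋆-zeroʳ (suc m) c = trans (cong (c 0 * 0 +_) (⋆-zeroʳ m (tail c))) (trans (+-identityʳ _) (*-zeroʳ (c 0)))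

⋆-distribˡ-+ : ∀ m (c f g : Series) → (c ⋆ (λ i → f i + g i)) m ≡ (c ⋆ f) m + (c ⋆ g) m
⋆-distribˡ-+ zero c f g = *-distribˡ-+ (c 0) (f 0) (g 0)
⋆-distribˡ-+ (suc m) c f g =
  trans (cong (c 0 * (f (suc m) + g (suc m)) +_) (⋆-distribˡ-+ m (tail c) f g))
        (trans (cong (_+ ((tail c ⋆ f) m + (tail c ⋆ g) m)) (*-distribˡ-+ (c 0) (f (suc m)) (g (suc m))))
               (+-CS.interchange (c 0 * f (suc m)) _ _ _))

⋆-scaleʳ : ∀ m k (c f : Series) → (c ⋆ (λ i → k * f i)) m ≡ k * (c ⋆ f) m
⋆-scaleʳ zero k c f = *-CS.x∙yz≈y∙xz (c 0) k (f 0)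
⋆-scaleʳ (suc m) k c f = trans (cong₂ _+_ (*-CS.x∙yz≈y∙xz (c 0) k (f (suc m))) (⋆-scaleʳ m k (tail c) f))
  (sym (*-distribˡ-+ k _ _))

⋆-∑<ʳ : ∀ n m (c : Series) (F : ℕ → Series) → (c ⋆ (λ i → ∑< n (λ j → F j i))) m ≡ ∑< n (λ j → (c ⋆ F j) m)
⋆-∑<ʳ zero m c F = ⋆-zeroʳ m c
⋆-∑<ʳ (suc n) m c F = trans (⋆-distribˡ-+ m c (F 0) _) (cong ((c ⋆ F 0) m +_) (⋆-∑<ʳ n m c (λ j → F (suc j))))

⋆-shiftˡ : ∀ j m (c f : Series) → (shift j c ⋆ f) m ≡ shift j (c ⋆ f) m
⋆-shiftˡ zero m c f = refl
⋆-shiftˡ (suc j) zero c f = refl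
⋆-shiftˡ (suc j) (suc m) c f = ⋆-shiftˡ j m c f

⋆-shift-swap : ∀ j m (c f : Series) → (c ⋆ shift j f) m ≡ (shift j c ⋆ f) m
⋆-shift-swap j m c f = begin
  (c ⋆ shift j f) m   ≡⟨ ⋆-comm m c (shift j f) ⟩
  (shift j f ⋆ c) m   ≡⟨ ⋆-shiftˡ j m f c ⟩
  shift j (f ⋆ c) m   ≡⟨ shift-cong-≤ j m (λ i _ → ⋆-comm i f c) ⟩
  shift j (c ⋆ f) m   ≡⟨ ⋆-shiftˡ j m c f ⟨
  (shift j c ⋆ f) m   ∎
  where open ≡-Reasoning

-- Linear systems with transposed correlation kernels

module TransposedSystems (ℓ' : ℕ) (w : Bool → ℕ) where

  Kernel : Set
  Kernel = Bool → Bool → ℕ → ℕ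

  correlationTerm : Kernel → (Bool → Series) → Bool → Series
  correlationTerm κ G x m = ∑< ℓ' (λ j → ∑₂ (λ y → κ x y j * (w y * shift (suc j) (G y) m)))

  weighted : (Bool → Series) → Series
  weighted G m = ∑₂ (λ x → w x * G x m)

  -- Coefficientwise, (1 - 2z) F = 1 + z^(ℓ'+1) Σ_x w_x G_x and G_x = F + Σ_y K_xy w_y G_y,
  -- where K_xy = Σ_{j<ℓ'} κ x y j z^(j+1).
  record System (κ : Kernel) (f : Series) (G : Bool → Series) : Set where
    field
      f-zero : f 0 ≡ 1
      f-suc  : ∀ n → f (suc n) ≡ f n + f n + shift (suc ℓ') (weighted G) (suc n)
      G-eq   : ∀ x m → G x m ≡ f m + correlationTerm κ G x m

  pairing : (Bool → Series) → (Bool → Series) → Series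
  pairing F G m = ∑₂ (λ y → w y * (F y ⋆ G y) m)

  cross : Kernel → (Bool → Series) → (Bool → Series) → Series
  cross κ F G m = ∑< ℓ' (λ j → ∑₂ (λ y → ∑₂ (λ x → κ y x j * (w y * (w x * (F y ⋆ shift (suc j) (G x)) m)))))

  pairing-comm : ∀ F G m → pairing F G m ≡ pairing G F m
  pairing-comm F G m = cong₂ _+_ (cong (w true *_) (⋆-comm m (F true) (G true)))
                                 (cong (w false *_) (⋆-comm m (F false) (G false)))

  ⋆-weighted : ∀ m (f : Series) F → (f ⋆ weighted F) m ≡ ∑₂ (λ y → w y * (F y ⋆ f) m)
  ⋆-weighted m f F = trans (⋆-distribˡ-+ m f _ _) (cong₂ _+_ (scaled true) (scaled false))
    where
    scaled : ∀ y → (f ⋆ (λ i → w y * F y i)) m ≡ w y * (F y ⋆ f) m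
    scaled y = trans (⋆-scaleʳ m (w y) f (F y)) (cong (w y *_) (⋆-comm m f (F y)))

  ⋆-correlationTerm : ∀ m κ (F G : Bool → Series) y → w y * (F y ⋆ correlationTerm κ G y) m ≡
    ∑< ℓ' (λ j → ∑₂ (λ x → κ y x j * (w y * (w x * (F y ⋆ shift (suc j) (G x)) m))))
  ⋆-correlationTerm m κ F G y = begin
      w y * (F y ⋆ correlationTerm κ G y) m
    ≡⟨ cong (w y *_) (⋆-∑<ʳ ℓ' m (F y) (λ j i → ∑₂ (λ x → κ y x j * (w x * shift (suc j) (G x) i)))) ⟩
      w y * ∑< ℓ' (λ j → (F y ⋆ (λ i → ∑₂ (λ x → κ y x j * (w x * shift (suc j) (G x) i)))) m)
    ≡⟨ ∑<-* ℓ' (w y) _ ⟨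
      ∑< ℓ' (λ j → w y * (F y ⋆ (λ i → ∑₂ (λ x → κ y x j * (w x * shift (suc j) (G x) i)))) m)
    ≡⟨ ∑<-cong ℓ' (λ j _ → trans (cong (w y *_) (⋆-distribˡ-+ m (F y) _ _))
                                (trans (*-distribˡ-+ (w y) _ _) (cong₂ _+_ (term j true) (term j false)))) ⟩
      ∑< ℓ' (λ j → ∑₂ (λ x → κ y x j * (w y * (w x * (F y ⋆ shift (suc j) (G x)) m))))
    ∎
    where
    open ≡-Reasoning
    term : ∀ j x → w y * (F y ⋆ (λ i → κ y x j * (w x * shift (suc j) (G x) i))) m ≡
                   κ y x j * (w y * (w x * (F y ⋆ shift (suc j) (G x)) m))
    term j x = trans (cong (w y *_) (trans (⋆-scaleʳ m (κ y x j) (F y) _)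
                                           (cong (κ y x j *_) (⋆-scaleʳ m (w x) (F y) _))))
                     (*-CS.x∙yz≈y∙xz (w y) (κ y x j) _)

  pairing-expand : ∀ {κ f G} → System κ f G → ∀ F m → pairing F G m ≡ (f ⋆ weighted F) m + cross κ F G m
  pairing-expand {κ} {f} {G} S F m = begin
      ∑₂ (λ y → w y * (F y ⋆ G y) m)
    ≡⟨ cong₂ _+_ (expand true) (expand false) ⟩
      ∑₂ (λ y → w y * (F y ⋆ f) m + w y * (F y ⋆ correlationTerm κ G y) m)
    ≡⟨ +-CS.interchange (w true * (F true ⋆ f) m) _ (w false * (F false ⋆ f) m) _ ⟩
      ∑₂ (λ y → w y * (F y ⋆ f) m) + ∑₂ (λ y → w y * (F y ⋆ correlationTerm κ G y) m)
    ≡⟨ cong₂ _+_ (sym (⋆-weighted m f F))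
                 (trans (cong₂ _+_ (⋆-correlationTerm m κ F G true) (⋆-correlationTerm m κ F G false))
                        (sym (∑<-∑₂ ℓ' (λ y j → ∑₂ (λ x → κ y x j * (w y * (w x * (F y ⋆ shift (suc j) (G x)) m))))))) ⟩
      (f ⋆ weighted F) m + cross κ F G m
    ∎
    where
    open ≡-Reasoning
    expand : ∀ y → w y * (F y ⋆ G y) m ≡ w y * (F y ⋆ f) m + w y * (F y ⋆ correlationTerm κ G y) m
    expand y = trans (cong (w y *_) (trans (⋆-cong m (λ _ → refl) (System.G-eq S y)) (⋆-distribˡ-+ m (F y) f _)))
                     (*-distribˡ-+ (w y) _ _)

  cross-transpose : ∀ {κ κ'} → (∀ x y j → j < ℓ' → κ' x y j ≡ κ y x j) → ∀ F G m → cross κ F G m ≡ cross κ' G F m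
  cross-transpose {κ} {κ'} κ'≡κᵀ F G m = ∑<-cong ℓ' (λ j j<ℓ' →
      trans (+-CS.interchange (κ true true j * _) (κ true false j * _) (κ false true j * _) (κ false false j * _))
            (cong₂ _+_ (cong₂ _+_ (term j j<ℓ' true true) (term j j<ℓ' false true))
                       (cong₂ _+_ (term j j<ℓ' true false) (term j j<ℓ' false false))))
    where
    term : ∀ j → j < ℓ' → ∀ y x → κ y x j * (w y * (w x * (F y ⋆ shift (suc j) (G x)) m)) ≡
                                   κ' x y j * (w x * (w y * (G x ⋆ shift (suc j) (F y)) m))
    term j j<ℓ' y x = cong₂ _*_ (sym (κ'≡κᵀ x y j j<ℓ'))
      (trans (*-CS.x∙yz≈y∙xz (w y) (w x) _)
             (cong (λ z → w x * (w y * z))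
                   (trans (⋆-shift-swap (suc j) m (F y) (G x)) (⋆-comm m _ (G x)))))

  module _ {κ κ' f f' G G'} (S : System κ f G) (S' : System κ' f' G')
           (κ'≡κᵀ : ∀ x y j → j < ℓ' → κ' x y j ≡ κ y x j) where

    open System

    -- Expand pairing G' G through the equations of G and pairing G G' through those of G':
    -- the cross terms coincide because κ' is the transpose of κ.
    f⋆weighted-symmetric : ∀ m → (f ⋆ weighted G') m ≡ (f' ⋆ weighted G) m
    f⋆weighted-symmetric m = +-cancelʳ-≡ (cross κ G' G m) _ _ (begin
        (f ⋆ weighted G') m + cross κ G' G m   ≡⟨ pairing-expand S G' m ⟨
        pairing G' G m                         ≡⟨ pairing-comm G' G m ⟩
        pairing G G' m                         ≡⟨ pairing-expand S' G m ⟩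
        (f' ⋆ weighted G) m + cross κ' G G' m  ≡⟨ cong ((f' ⋆ weighted G) m +_) (cross-transpose κ'≡κᵀ G' G m) ⟨
        (f' ⋆ weighted G) m + cross κ G' G m   ∎)
      where open ≡-Reasoning

    cancel-leading : ∀ {a b} → f 0 * a ≡ f' 0 * b → a ≡ b
    cancel-leading {a} {b} e = begin
      a           ≡⟨ *-identityˡ a ⟨
      1 * a       ≡⟨ cong (_* a) (f-zero S) ⟨
      f 0 * a     ≡⟨ e ⟩
      f' 0 * b    ≡⟨ cong (_* b) (f-zero S') ⟩
      1 * b       ≡⟨ *-identityˡ b ⟩
      b           ∎
      where open ≡-Reasoning

    AgreeUpTo : ℕ → Set
    AgreeUpTo m = ∀ i → i ≤ m → f i ≡ f' i × weighted G i ≡ weighted G' i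

    agree-zero : AgreeUpTo 0
    agree-zero .0 z≤n = trans (f-zero S) (sym (f-zero S')) , sym (cancel-leading (f⋆weighted-symmetric 0))

    -- f (m+1) only involves weighted G below m+1, and since f 0 = f' 0 = 1 the coefficient m+1 of
    -- f⋆weighted-symmetric then determines weighted G' (m+1).
    agree-suc : ∀ m → AgreeUpTo m → AgreeUpTo (suc m)
    agree-suc m hyp i i≤1+m with m≤n⇒m<n∨m≡n i≤1+m
    ... | inj₁ i<1+m = hyp i (s≤s⁻¹ i<1+m)
    ... | inj₂ refl = f-next , weighted-next
      where
      f-next : f (suc m) ≡ f' (suc m)
      f-next = begin
        f (suc m)                                           ≡⟨ f-suc S m ⟩
        f m + f m + shift ℓ' (weighted G) m                 ≡⟨ cong₂ (λ a b → a + a + b) (proj₁ (hyp m ≤-refl))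
                                                                 (shift-cong-≤ ℓ' m (λ i i≤m → proj₂ (hyp i i≤m))) ⟩
        f' m + f' m + shift ℓ' (weighted G') m              ≡⟨ f-suc S' m ⟨
        f' (suc m)                                          ∎
        where open ≡-Reasoning
      tail-f : ∀ i → i ≤ m → f (suc i) ≡ f' (suc i)
      tail-f i i≤m with m≤n⇒m<n∨m≡n i≤m
      ... | inj₁ i<m = proj₁ (hyp (suc i) i<m)
      ... | inj₂ refl = f-next
      weighted-next : weighted G (suc m) ≡ weighted G' (suc m)
      weighted-next = sym (cancel-leading (+-cancelʳ-≡ _ _ _ (trans (f⋆weighted-symmetric (suc m))
        (cong (f' 0 * weighted G (suc m) +_)
              (⋆-cong-≤ m (λ i i≤m → sym (tail-f i i≤m)) (λ i i≤m → proj₂ (hyp i i≤m)))))))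

    agree : ∀ m → AgreeUpTo m
    agree zero = agree-zero
    agree (suc m) = agree-suc m (agree m)

    systems-agree : ∀ n → f n ≡ f' n
    systems-agree n = proj₁ (agree n n ≤-refl)

-- Prefixes, occurrences and sums over all words

[_≼_] : List Letter → List Letter → ℕ
[ [] ≼ Z ] = 1
[ u ∷ U ≼ [] ] = 0
[ H ∷ U ≼ H ∷ Z ] = [ U ≼ Z ]
[ H ∷ U ≼ T ∷ Z ] = 0
[ T ∷ U ≼ H ∷ Z ] = 0
[ T ∷ U ≼ T ∷ Z ] = [ U ≼ Z ]

occurrences : List Letter → List Letter → ℕ
occurrences U [] = 0
occurrences U (c ∷ Z) = [ U ≼ c ∷ Z ] + occurrences U Z

[≼]-binary : ∀ U Z → [ U ≼ Z ] ≡ 0 ⊎ [ U ≼ Z ] ≡ 1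
[≼]-binary [] Z = inj₂ refl
[≼]-binary (u ∷ U) [] = inj₁ refl
[≼]-binary (H ∷ U) (H ∷ Z) = [≼]-binary U Z
[≼]-binary (H ∷ U) (T ∷ Z) = inj₁ refl
[≼]-binary (T ∷ U) (H ∷ Z) = inj₁ refl
[≼]-binary (T ∷ U) (T ∷ Z) = [≼]-binary U Z

≼-refl : ∀ U → [ U ≼ U ] ≡ 1
≼-refl [] = refl
≼-refl (H ∷ U) = ≼-refl U
≼-refl (T ∷ U) = ≼-refl U

≼-unique : ∀ U V Z → length U ≡ length V → [ U ≼ Z ] ≡ 1 → [ V ≼ Z ] ≡ 1 → U ≡ V
≼-unique [] [] Z _ _ _ = refl
≼-unique (H ∷ U) (H ∷ V) (H ∷ Z) |U|≡|V| U≼Z V≼Z = cong (H ∷_) (≼-unique U V Z (suc-injective |U|≡|V|) U≼Z V≼Z)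
≼-unique (T ∷ U) (T ∷ V) (T ∷ Z) |U|≡|V| U≼Z V≼Z = cong (T ∷_) (≼-unique U V Z (suc-injective |U|≡|V|) U≼Z V≼Z)
≼-unique (H ∷ U) (T ∷ V) (H ∷ Z) _ _ ()
≼-unique (T ∷ U) (H ∷ V) (T ∷ Z) _ _ ()
≼-unique (H ∷ U) (_ ∷ V) (T ∷ Z) _ ()
≼-unique (T ∷ U) (_ ∷ V) (H ∷ Z) _ ()
≼-unique (_ ∷ U) (_ ∷ V) [] _ ()

≼-++ : ∀ V V' S Y → length V ≡ length S → [ V ++ V' ≼ S ++ Y ] ≡ [ V ≼ S ] * [ V' ≼ Y ]
≼-++ [] V' [] Y _ = sym (+-identityʳ _)
≼-++ (H ∷ V) V' (H ∷ S) Y |V|≡|S| = ≼-++ V V' S Y (suc-injective |V|≡|S|)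
≼-++ (H ∷ V) V' (T ∷ S) Y _ = refl
≼-++ (T ∷ V) V' (H ∷ S) Y _ = refl
≼-++ (T ∷ V) V' (T ∷ S) Y |V|≡|S| = ≼-++ V V' S Y (suc-injective |V|≡|S|)

≼-subst : ∀ U S (h : List Letter → ℕ) → length U ≡ length S → [ U ≼ S ] * h S ≡ [ U ≼ S ] * h U
≼-subst U S h |U|≡|S| with [≼]-binary U S
... | inj₁ U⋠S rewrite U⋠S = refl
... | inj₂ U≼S rewrite U≼S | ≼-unique U S S |U|≡|S| U≼S (≼-refl S) = refl

≼-short : ∀ U Z → length Z < length U → [ U ≼ Z ] ≡ 0
≼-short (u ∷ U) [] _ = refl
≼-short (H ∷ U) (H ∷ Z) (s≤s |Z|<|U|) = ≼-short U Z |Z|<|U|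
≼-short (H ∷ U) (T ∷ Z) _ = refl
≼-short (T ∷ U) (H ∷ Z) _ = refl
≼-short (T ∷ U) (T ∷ Z) (s≤s |Z|<|U|) = ≼-short U Z |Z|<|U|

𝟙-take≡ : ∀ U Z → 𝟙 (≡-dec _≟L_ (take (length U) Z) U) ≡ [ U ≼ Z ]
𝟙-take≡ [] Z = refl
𝟙-take≡ (u ∷ U) [] = refl
𝟙-take≡ (H ∷ U) (H ∷ Z) = 𝟙-take≡ U Z
𝟙-take≡ (H ∷ U) (T ∷ Z) = refl
𝟙-take≡ (T ∷ U) (H ∷ Z) = refl
𝟙-take≡ (T ∷ U) (T ∷ Z) = 𝟙-take≡ U Z

drop-++ : ∀ {A : Set} k (V Y : List A) → k ≤ length V → drop k (V ++ Y) ≡ drop k V ++ Y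
drop-++ zero V Y _ = refl
drop-++ (suc k) (v ∷ V) Y (s≤s k≤|V|) = drop-++ k V Y k≤|V|

words : ℕ → List (List Letter)
words zero = [] ∷ []
words (suc n) = map (H ∷_) (words n) ++ map (T ∷_) (words n)

∑-words-suc : ∀ n g → ∑ (words (suc n)) g ≡ ∑ (words n) (λ X → g (H ∷ X)) + ∑ (words n) (λ X → g (T ∷ X))
∑-words-suc n g = trans (∑-++ (map (H ∷_) (words n)) _ g) (cong₂ _+_ (∑-map (words n) (H ∷_) g) (∑-map (words n) (T ∷_) g))

∑-words-prefix : ∀ U m (h : List Letter → ℕ) →
  ∑ (words m) (λ Y → [ U ≼ Y ] * h Y) ≡ shift (length U) (λ m' → ∑ (words m') (λ Y → h (U ++ Y))) m
∑-words-prefix [] m h = ∑-cong (words m) (λ Y → +-identityʳ (h Y))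
∑-words-prefix (u ∷ U) zero h = refl
∑-words-prefix (H ∷ U) (suc m) h = trans (∑-words-suc m _)
  (trans (cong₂ _+_ (∑-words-prefix U m (λ Y → h (H ∷ Y))) (∑-zero (words m))) (+-identityʳ _))
∑-words-prefix (T ∷ U) (suc m) h = trans (∑-words-suc m _)
  (cong₂ _+_ (∑-zero (words m)) (∑-words-prefix U m (λ Y → h (T ∷ Y))))

∑-words-overlap : ∀ m (h : List Letter → ℕ) V S → length S ≤ length V →
  ∑ (words m) (λ Y → [ V ≼ S ++ Y ] * h (S ++ Y)) ≡
  [ take (length S) V ≼ S ] * shift (length V ∸ length S) (λ m' → ∑ (words m') (λ Y → h (V ++ Y))) m
∑-words-overlap m h V S |S|≤|V| = begin
    ∑ (words m) (λ Y → [ V ≼ S ++ Y ] * h (S ++ Y))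
  ≡⟨ ∑-cong (words m) (λ Y → cong (_* h (S ++ Y))
       (trans (cong (λ V' → [ V' ≼ S ++ Y ]) (sym (take++drop≡id (length S) V))) (≼-++ V₁ V₂ S Y |V₁|≡|S|))) ⟩
    ∑ (words m) (λ Y → [ V₁ ≼ S ] * [ V₂ ≼ Y ] * h (S ++ Y))
  ≡⟨ ∑-cong (words m) (λ Y → *-assoc [ V₁ ≼ S ] _ _) ⟩
    ∑ (words m) (λ Y → [ V₁ ≼ S ] * ([ V₂ ≼ Y ] * h (S ++ Y)))
  ≡⟨ ∑-* (words m) [ V₁ ≼ S ] _ ⟩
    [ V₁ ≼ S ] * ∑ (words m) (λ Y → [ V₂ ≼ Y ] * h (S ++ Y))
  ≡⟨ ≼-subst V₁ S (λ S' → ∑ (words m) (λ Y → [ V₂ ≼ Y ] * h (S' ++ Y))) |V₁|≡|S| ⟩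
    [ V₁ ≼ S ] * ∑ (words m) (λ Y → [ V₂ ≼ Y ] * h (V₁ ++ Y))
  ≡⟨ cong ([ V₁ ≼ S ] *_) (∑-words-prefix V₂ m (λ Y → h (V₁ ++ Y))) ⟩
    [ V₁ ≼ S ] * shift (length V₂) (λ m' → ∑ (words m') (λ Y → h (V₁ ++ V₂ ++ Y))) m
  ≡⟨ cong (λ k → [ V₁ ≼ S ] * shift k (λ m' → ∑ (words m') (λ Y → h (V₁ ++ V₂ ++ Y))) m) (length-drop (length S) V) ⟩
    [ V₁ ≼ S ] * shift (length V ∸ length S) (λ m' → ∑ (words m') (λ Y → h (V₁ ++ V₂ ++ Y))) m
  ≡⟨ cong ([ V₁ ≼ S ] *_) (shift-cong-≤ (length V ∸ length S) m (λ i _ → ∑-cong (words i) (λ Y →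
       cong h (trans (sym (++-assoc V₁ V₂ Y)) (cong (_++ Y) (take++drop≡id (length S) V)))))) ⟩
    [ V₁ ≼ S ] * shift (length V ∸ length S) (λ m' → ∑ (words m') (λ Y → h (V ++ Y))) m
  ∎
  where
  open ≡-Reasoning
  V₁ V₂ : List Letter
  V₁ = take (length S) V
  V₂ = drop (length S) V
  |V₁|≡|S| : length V₁ ≡ length S
  |V₁|≡|S| = trans (length-take (length S) V) (m≤n⇒m⊓n≡m |S|≤|V|)

∑-allSeqs : ∀ n (g : List Letter → ℕ) → ∑ (allSeqs n) (λ X → g (toList X)) ≡ ∑ (words n) g
∑-allSeqs zero g = refl
∑-allSeqs (suc n) g = begin
    ∑ (map (H ∷ᵥ_) (allSeqs n) ++ map (T ∷ᵥ_) (allSeqs n)) (λ X → g (toList X))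
  ≡⟨ ∑-++ (map (H ∷ᵥ_) (allSeqs n)) _ _ ⟩
    ∑ (map (H ∷ᵥ_) (allSeqs n)) (λ X → g (toList X)) + ∑ (map (T ∷ᵥ_) (allSeqs n)) (λ X → g (toList X))
  ≡⟨ cong₂ _+_ (trans (∑-map (allSeqs n) (H ∷ᵥ_) _) (∑-allSeqs n (λ Z → g (H ∷ Z))))
               (trans (∑-map (allSeqs n) (T ∷ᵥ_) _) (∑-allSeqs n (λ Z → g (T ∷ Z)))) ⟩
    ∑ (words n) (λ Z → g (H ∷ Z)) + ∑ (words n) (λ Z → g (T ∷ Z))
  ≡⟨ ∑-words-suc n g ⟨
    ∑ (words (suc n)) g
  ∎
  where open ≡-Reasoning

-- Weighted words

1+n∸[n∸j]≡1+j : ∀ {n j} → j ≤ n → suc n ∸ (n ∸ j) ≡ suc j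
1+n∸[n∸j]≡1+j {n} {j} j≤n = trans (+-∸-assoc 1 (m∸n≤m n j)) (cong suc (m∸[m∸n]≡n j≤n))

suc-^-binary : ∀ a p → p ≡ 0 ⊎ p ≡ 1 → suc a ^ p ≡ 1 + a * p
suc-^-binary a .0 (inj₁ refl) = cong suc (sym (*-zeroʳ a))
suc-^-binary a .1 (inj₂ refl) = cong suc (trans (*-identityʳ a) (sym (*-identityʳ a)))

module WeightedWords (ℓ' : ℕ) (W : Bool → List Letter) (w : Bool → ℕ)
                     (|W|≡1+ℓ' : ∀ x → length (W x) ≡ suc ℓ') (W-distinct : W true ≢ W false) where

  open TransposedSystems ℓ' w

  weight : List Letter → ℕ
  weight Z = suc (w true) ^ occurrences (W true) Z * suc (w false) ^ occurrences (W false) Z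

  leadingWeight : List Letter → ℕ
  leadingWeight Z = ∑₂ (λ x → w x * [ W x ≼ Z ])

  gain : List Letter → ℕ
  gain Z = leadingWeight Z * weight (drop 1 Z)

  W⋠[] : ∀ x → [ W x ≼ [] ] ≡ 0
  W⋠[] x with W x | |W|≡1+ℓ' x
  ... | _ ∷ _ | _ = refl

  W-exclusive : ∀ Z → [ W true ≼ Z ] * [ W false ≼ Z ] ≡ 0
  W-exclusive Z with [≼]-binary (W true) Z | [≼]-binary (W false) Z
  ... | inj₁ p | _ rewrite p = refl
  ... | inj₂ _ | inj₁ q rewrite q = *-zeroʳ [ W true ≼ Z ]
  ... | inj₂ p | inj₂ q = contradiction (≼-unique (W true) (W false) Z (trans (|W|≡1+ℓ' true) (sym (|W|≡1+ℓ' false))) p q) W-distinct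

  weight-step : ∀ Z → weight Z ≡ weight (drop 1 Z) + gain Z
  weight-step [] rewrite W⋠[] true | W⋠[] false =
    sym (cong suc (trans (*-identityʳ _) (cong₂ _+_ (*-zeroʳ (w true)) (*-zeroʳ (w false)))))
  weight-step (c ∷ Z) = begin
      suc a ^ (p + n) * suc b ^ (q + n')
    ≡⟨ cong₂ _*_ (^-distribˡ-+-* (suc a) p n) (^-distribˡ-+-* (suc b) q n') ⟩
      (suc a ^ p * X) * (suc b ^ q * Y)
    ≡⟨ cong₂ (λ u v → (u * X) * (v * Y)) (suc-^-binary a p ([≼]-binary (W true) (c ∷ Z)))
                                          (suc-^-binary b q ([≼]-binary (W false) (c ∷ Z))) ⟩
      ((1 + a * p) * X) * ((1 + b * q) * Y)
    ≡⟨ expand a b p q X Y ⟩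
      X * Y + (a * p + b * q) * (X * Y) + a * b * (p * q) * (X * Y)
    ≡⟨ cong (λ r → X * Y + (a * p + b * q) * (X * Y) + a * b * r * (X * Y)) (W-exclusive (c ∷ Z)) ⟩
      X * Y + (a * p + b * q) * (X * Y) + a * b * 0 * (X * Y)
    ≡⟨ cong (X * Y + (a * p + b * q) * (X * Y) +_) (cong (_* (X * Y)) (*-zeroʳ (a * b))) ⟩
      X * Y + (a * p + b * q) * (X * Y) + 0
    ≡⟨ +-identityʳ _ ⟩
      weight Z + gain (c ∷ Z)
    ∎
    where
    open ≡-Reasoning
    a b p q n n' X Y : ℕ
    a = w true
    b = w false
    p = [ W true ≼ c ∷ Z ]
    q = [ W false ≼ c ∷ Z ]
    n = occurrences (W true) Z
    n' = occurrences (W false) Z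
    X = suc a ^ n
    Y = suc b ^ n'
    expand : ∀ a b p q X Y → ((1 + a * p) * X) * ((1 + b * q) * Y) ≡
                             X * Y + (a * p + b * q) * (X * Y) + a * b * (p * q) * (X * Y)
    expand = solve-∀

  weight-telescope : ∀ r Z → weight Z ≡ weight (drop r Z) + ∑< r (λ j → gain (drop j Z))
  weight-telescope zero Z = sym (+-identityʳ (weight Z))
  weight-telescope (suc r) Z = begin
      weight Z
    ≡⟨ weight-step Z ⟩
      weight (drop 1 Z) + gain Z
    ≡⟨ cong (_+ gain Z) (weight-telescope r (drop 1 Z)) ⟩
      weight (drop r (drop 1 Z)) + ∑< r (λ j → gain (drop j (drop 1 Z))) + gain Z
    ≡⟨ cong₂ (λ u v → weight u + v + gain Z) (drop-drop 1 r Z) (∑<-cong r (λ j _ → cong gain (drop-drop 1 j Z))) ⟩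
      weight (drop (suc r) Z) + ∑< r (λ j → gain (drop (suc j) Z)) + gain Z
    ≡⟨ +-CS.xy∙z≈x∙zy (weight (drop (suc r) Z)) _ (gain Z) ⟩
      weight (drop (suc r) Z) + ∑< (suc r) (λ j → gain (drop j Z))
    ∎
    where open ≡-Reasoning

  ∑-gain : ∀ {A : Set} (xs : List A) (Z : A → List Letter) →
    ∑ xs (λ a → gain (Z a)) ≡ ∑₂ (λ y → w y * ∑ xs (λ a → [ W y ≼ Z a ] * weight (drop 1 (Z a))))
  ∑-gain xs Z = trans (∑-cong xs (λ a → distribute (w true) (w false) _ _ (weight (drop 1 (Z a)))))
    (trans (∑-+ xs _ _) (cong₂ _+_ (∑-* xs (w true) _) (∑-* xs (w false) _)))
    where
    distribute : ∀ a b p q h → (a * p + b * q) * h ≡ a * (p * h) + b * (q * h)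
    distribute = solve-∀

  f : Series
  f n = ∑ (words n) weight

  -- The occurrence of W x at the front is not counted: its first letter is dropped.
  G : Bool → Series
  G x m = ∑ (words m) (λ Y → weight (drop 1 (W x ++ Y)))

  κ : Kernel
  κ x y j = [ take (ℓ' ∸ j) (W y) ≼ drop (suc j) (W x) ]

  f-suc : ∀ n → f (suc n) ≡ f n + f n + shift (suc ℓ') (weighted G) (suc n)
  f-suc n = begin
      ∑ (words (suc n)) weight
    ≡⟨ ∑-cong (words (suc n)) weight-step ⟩
      ∑ (words (suc n)) (λ Z → weight (drop 1 Z) + gain Z)
    ≡⟨ ∑-+ (words (suc n)) _ _ ⟩
      ∑ (words (suc n)) (λ Z → weight (drop 1 Z)) + ∑ (words (suc n)) gain
    ≡⟨ cong₂ _+_ (∑-words-suc n (λ Z → weight (drop 1 Z))) (∑-gain (words (suc n)) (λ Z → Z)) ⟩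
      f n + f n + ∑₂ (λ y → w y * ∑ (words (suc n)) (λ Z → [ W y ≼ Z ] * weight (drop 1 Z)))
    ≡⟨ cong (f n + f n +_) (cong₂ _+_ (cong (w true *_) (prefixed true)) (cong (w false *_) (prefixed false))) ⟩
      f n + f n + ∑₂ (λ y → w y * shift (suc ℓ') (G y) (suc n))
    ≡⟨ cong (f n + f n +_) (shift-linear (suc ℓ') (suc n) (G true) (G false) (w true) (w false)) ⟨
      f n + f n + shift (suc ℓ') (weighted G) (suc n)
    ∎
    where
    open ≡-Reasoning
    prefixed : ∀ y → ∑ (words (suc n)) (λ Z → [ W y ≼ Z ] * weight (drop 1 Z)) ≡ shift (suc ℓ') (G y) (suc n)
    prefixed y = trans (∑-words-prefix (W y) (suc n) (λ Z → weight (drop 1 Z)))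
                       (cong (λ k → shift k (G y) (suc n)) (|W|≡1+ℓ' y))

  |suffix|≡ : ∀ x j → length (drop (suc j) (W x)) ≡ ℓ' ∸ j
  |suffix|≡ x j = trans (length-drop (suc j) (W x)) (cong (_∸ suc j) (|W|≡1+ℓ' x))

  drop-W++ : ∀ x j Y → j ≤ ℓ' → drop j (drop 1 (W x ++ Y)) ≡ drop (suc j) (W x) ++ Y
  drop-W++ x j Y j≤ℓ' = trans (drop-drop 1 j (W x ++ Y))
                              (drop-++ (suc j) (W x) Y (≤-trans (s≤s j≤ℓ') (≤-reflexive (sym (|W|≡1+ℓ' x)))))

  ∑-gain-overlap : ∀ m x j → j < ℓ' →
    ∑ (words m) (λ Y → gain (drop (suc j) (W x) ++ Y)) ≡ ∑₂ (λ y → κ x y j * (w y * shift (suc j) (G y) m))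
  ∑-gain-overlap m x j j<ℓ' = trans (∑-gain (words m) (S ++_)) (cong₂ _+_ (term true) (term false))
    where
    S : List Letter
    S = drop (suc j) (W x)
    overlap-length : ∀ y → length (W y) ∸ length S ≡ suc j
    overlap-length y = begin
      length (W y) ∸ length S   ≡⟨ cong₂ _∸_ (|W|≡1+ℓ' y) (|suffix|≡ x j) ⟩
      suc ℓ' ∸ (ℓ' ∸ j)         ≡⟨ 1+n∸[n∸j]≡1+j (<⇒≤ j<ℓ') ⟩
      suc j                     ∎
      where open ≡-Reasoning
    |S|≤|W| : ∀ y → length S ≤ length (W y)
    |S|≤|W| y = ≤-trans (≤-reflexive (|suffix|≡ x j))
                        (≤-trans (m∸n≤m ℓ' j) (≤-trans (n≤1+n ℓ') (≤-reflexive (sym (|W|≡1+ℓ' y)))))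
    term : ∀ y → w y * ∑ (words m) (λ Y → [ W y ≼ S ++ Y ] * weight (drop 1 (S ++ Y))) ≡ κ x y j * (w y * shift (suc j) (G y) m)
    term y = trans (cong (w y *_) (trans (∑-words-overlap m (λ Z → weight (drop 1 Z)) (W y) S (|S|≤|W| y))
                     (cong₂ (λ a b → [ take a (W y) ≼ S ] * shift b (G y) m) (|suffix|≡ x j) (overlap-length y))))
                   (*-CS.x∙yz≈y∙xz (w y) (κ x y j) _)

  G-eq : ∀ x m → G x m ≡ f m + correlationTerm κ G x m
  G-eq x m = begin
      ∑ (words m) (λ Y → weight (drop 1 (W x ++ Y)))
    ≡⟨ ∑-cong (words m) (λ Y → weight-telescope ℓ' (drop 1 (W x ++ Y))) ⟩
      ∑ (words m) (λ Y → weight (drop ℓ' (drop 1 (W x ++ Y))) + ∑< ℓ' (λ j → gain (drop j (drop 1 (W x ++ Y)))))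
    ≡⟨ ∑-cong (words m) (λ Y → cong₂ _+_ (cong weight (drop-all-W++ Y))
                                         (∑<-cong ℓ' (λ j j<ℓ' → cong gain (drop-W++ x j Y (<⇒≤ j<ℓ'))))) ⟩
      ∑ (words m) (λ Y → weight Y + ∑< ℓ' (λ j → gain (drop (suc j) (W x) ++ Y)))
    ≡⟨ ∑-+ (words m) weight _ ⟩
      f m + ∑ (words m) (λ Y → ∑< ℓ' (λ j → gain (drop (suc j) (W x) ++ Y)))
    ≡⟨ cong (f m +_) (∑-∑< (words m) ℓ' _) ⟩
      f m + ∑< ℓ' (λ j → ∑ (words m) (λ Y → gain (drop (suc j) (W x) ++ Y)))
    ≡⟨ cong (f m +_) (∑<-cong ℓ' (∑-gain-overlap m x)) ⟩
      f m + correlationTerm κ G x m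
    ∎
    where
    open ≡-Reasoning
    drop-all-W++ : ∀ Y → drop ℓ' (drop 1 (W x ++ Y)) ≡ Y
    drop-all-W++ Y = trans (drop-W++ x ℓ' Y ≤-refl)
                           (cong (_++ Y) (drop-all (suc ℓ') (W x) (≤-reflexive (|W|≡1+ℓ' x))))

  system : System κ f G
  system = record { f-zero = refl ; f-suc = f-suc ; G-eq = G-eq }

-- Occurrences as counted by N

window-∷ : ∀ ℓ k c (xs : List Letter) → ℓ ≤ k → window ℓ (suc k) (c ∷ xs) ≡ window ℓ k xs
window-∷ ℓ k c xs ℓ≤k = cong (λ i → take ℓ (drop i (c ∷ xs))) (+-∸-assoc 1 ℓ≤k)

module _ (ℓ' : ℕ) (U : List Letter) (|U|≡1+ℓ' : length U ≡ suc ℓ') where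

  endsAt : List Letter → ℕ → ℕ
  endsAt xs k = 𝟙 ((suc ℓ' ≤? k) ×-dec ≡-dec _≟L_ (window (suc ℓ') k xs) U)

  endsAt-∷ : ∀ c xs k → endsAt (c ∷ xs) (suc k) ≡ endsAt xs k + δ ℓ' k * [ U ≼ c ∷ xs ]
  endsAt-∷ c xs k with <-cmp k ℓ'
  ... | tri< k<ℓ' _ _
    rewrite dec-false (suc ℓ' ≤? suc k) (λ ℓ'<1+k → <⇒≱ k<ℓ' (s≤s⁻¹ ℓ'<1+k))
          | dec-false (suc ℓ' ≤? k) (λ ℓ'<k → <⇒≱ k<ℓ' (≤-trans (n≤1+n ℓ') ℓ'<k))
          | dec-false (ℓ' ≟ k) (>⇒≢ k<ℓ') = refl
  ... | tri≈ _ refl _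
    rewrite dec-true (suc ℓ' ≤? suc ℓ') ≤-refl
          | dec-false (suc ℓ' ≤? ℓ') (1+n≰n {ℓ'})
          | dec-true (ℓ' ≟ ℓ') refl
          | n∸n≡0 ℓ' = trans (cong (λ i → 𝟙 (≡-dec _≟L_ (take i (c ∷ xs)) U)) (sym |U|≡1+ℓ'))
                             (trans (𝟙-take≡ U (c ∷ xs)) (sym (+-identityʳ _)))
  ... | tri> _ _ ℓ'<k
    rewrite dec-true (suc ℓ' ≤? suc k) (m≤n⇒m≤1+n ℓ'<k)
          | dec-true (suc ℓ' ≤? k) ℓ'<k
          | dec-false (ℓ' ≟ k) (<⇒≢ ℓ'<k)
          | window-∷ (suc ℓ') k c xs ℓ'<k = sym (+-identityʳ _)

  ∑<-endsAt : ∀ xs → ∑< (suc (length xs)) (endsAt xs) ≡ occurrences U xs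
  ∑<-endsAt [] = refl
  ∑<-endsAt (c ∷ xs) = begin
      ∑< (suc (suc (length xs))) (endsAt (c ∷ xs))
    ≡⟨ ∑<-cong (suc (length xs)) (λ k _ → endsAt-∷ c xs k) ⟩
      ∑< (suc (length xs)) (λ k → endsAt xs k + δ ℓ' k * [ U ≼ c ∷ xs ])
    ≡⟨ ∑<-+ (suc (length xs)) (endsAt xs) (λ k → δ ℓ' k * [ U ≼ c ∷ xs ]) ⟩
      ∑< (suc (length xs)) (endsAt xs) + ∑< (suc (length xs)) (λ k → δ ℓ' k * [ U ≼ c ∷ xs ])
    ≡⟨ cong₂ _+_ (∑<-endsAt xs) starts-here ⟩
      occurrences U xs + [ U ≼ c ∷ xs ]
    ≡⟨ +-comm (occurrences U xs) _ ⟩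
      occurrences U (c ∷ xs)
    ∎
    where
    open ≡-Reasoning
    starts-here : ∑< (suc (length xs)) (λ k → δ ℓ' k * [ U ≼ c ∷ xs ]) ≡ [ U ≼ c ∷ xs ]
    starts-here with ℓ' ≤? length xs
    ... | yes ℓ'≤|xs| = ∑<-δ (suc (length xs)) ℓ' (λ _ → [ U ≼ c ∷ xs ]) (s≤s ℓ'≤|xs|)
    ... | no ℓ'≰|xs| = trans (∑<-δ-beyond (suc (length xs)) ℓ' (λ _ → [ U ≼ c ∷ xs ]) (≰⇒> ℓ'≰|xs|))
                            (sym (≼-short U (c ∷ xs) (≤-trans (s≤s (≰⇒> ℓ'≰|xs|)) (≤-reflexive (sym |U|≡1+ℓ')))))

N≡occurrences : ∀ {ℓ' n} (A : Word (suc ℓ')) (X : Vec Letter n) → N A X ≡ occurrences (toList A) (toList X)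
N≡occurrences {ℓ'} {n} A X = begin
    N A X
  ≡⟨ length-filter-∑ (λ k → (suc ℓ' ≤? k) ×-dec ≡-dec _≟L_ (window (suc ℓ') k (toList X)) (toList A)) (upTo (suc n)) ⟩
    ∑ (upTo (suc n)) (endsAt' (toList X))
  ≡⟨ ∑-applyUpTo (suc n) (λ k → k) (endsAt' (toList X)) ⟩
    ∑< (suc n) (endsAt' (toList X))
  ≡⟨ cong (λ i → ∑< (suc i) (endsAt' (toList X))) (sym (Vec.length-toList X)) ⟩
    ∑< (suc (length (toList X))) (endsAt' (toList X))
  ≡⟨ ∑<-endsAt ℓ' (toList A) (Vec.length-toList A) (toList X) ⟩
    occurrences (toList A) (toList X)
  ∎
  where
  open ≡-Reasoning
  endsAt' : List Letter → ℕ → ℕ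
  endsAt' = endsAt ℓ' (toList A) (Vec.length-toList A)

occurrences-≤-length : ∀ U Z → occurrences U Z ≤ length Z
occurrences-≤-length U [] = z≤n
occurrences-≤-length U (c ∷ Z) = +-mono-≤ [≼]≤1 (occurrences-≤-length U Z)
  where
  [≼]≤1 : [ U ≼ c ∷ Z ] ≤ 1
  [≼]≤1 with [≼]-binary U (c ∷ Z)
  ... | inj₁ U⋠Z rewrite U⋠Z = z≤n
  ... | inj₂ U≼Z rewrite U≼Z = ≤-refl

-- Self-overlaps and correlations

binary-≡ : ∀ {a b} → a ≡ 0 ⊎ a ≡ 1 → b ≡ 0 ⊎ b ≡ 1 → a ≡ 1 ⇔ b ≡ 1 → a ≡ b
binary-≡ (inj₁ refl) (inj₁ refl) _ = refl
binary-≡ (inj₁ refl) (inj₂ refl) a⇔b = Equivalence.from a⇔b refl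
binary-≡ (inj₂ refl) (inj₁ refl) a⇔b = sym (Equivalence.to a⇔b refl)
binary-≡ (inj₂ refl) (inj₂ refl) _ = refl

self-overlap⇔ : ∀ ℓ' V j → length V ≡ suc ℓ' → j < ℓ' →
  [ take (ℓ' ∸ j) V ≼ drop (suc j) V ] ≡ 1 ⇔ drop (suc j) V ≡ take (ℓ' ∸ j) V
self-overlap⇔ ℓ' V j |V|≡1+ℓ' j<ℓ' = mk⇔
  (λ t≼d → sym (≼-unique (take (ℓ' ∸ j) V) (drop (suc j) V) (drop (suc j) V) equal-lengths t≼d (≼-refl (drop (suc j) V))))
  (λ d≡t → trans (cong ([ take (ℓ' ∸ j) V ≼_]) d≡t) (≼-refl (take (ℓ' ∸ j) V)))
  where
  equal-lengths : length (take (ℓ' ∸ j) V) ≡ length (drop (suc j) V)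
  equal-lengths = begin
    length (take (ℓ' ∸ j) V)    ≡⟨ length-take (ℓ' ∸ j) V ⟩
    (ℓ' ∸ j) ⊓ length V         ≡⟨ m≤n⇒m⊓n≡m (≤-trans (m∸n≤m ℓ' j) (≤-trans (n≤1+n ℓ') (≤-reflexive (sym |V|≡1+ℓ')))) ⟩
    ℓ' ∸ j                      ≡⟨ cong (_∸ suc j) |V|≡1+ℓ' ⟨
    length V ∸ suc j            ≡⟨ length-drop (suc j) V ⟨
    length (drop (suc j) V)     ∎
    where open ≡-Reasoning

self-overlap⇔Cor : ∀ {ℓ'} (A : Word (suc ℓ')) j → j < ℓ' →
  [ take (ℓ' ∸ j) (toList A) ≼ drop (suc j) (toList A) ] ≡ 1 ⇔ Cor A A (ℓ' ∸ j)
self-overlap⇔Cor {ℓ'} A j j<ℓ' = mk⇔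
  (λ t≼d → m<n⇒0<n∸m j<ℓ' , m∸n≤m ℓ' j ,
               trans (cong (λ i → drop i (toList A)) (1+n∸[n∸j]≡1+j (<⇒≤ j<ℓ'))) (Equivalence.to overlap⇔ t≼d))
  (λ { (_ , _ , d≡t) → Equivalence.from overlap⇔
         (trans (cong (λ i → drop i (toList A)) (sym (1+n∸[n∸j]≡1+j (<⇒≤ j<ℓ')))) d≡t) })
  where
  overlap⇔ : [ take (ℓ' ∸ j) (toList A) ≼ drop (suc j) (toList A) ] ≡ 1 ⇔ drop (suc j) (toList A) ≡ take (ℓ' ∸ j) (toList A)
  overlap⇔ = self-overlap⇔ ℓ' (toList A) j (Vec.length-toList A) j<ℓ'

-- The symmetry

module Symmetry {ℓ'} (A B : Word (suc ℓ')) (A≢B : A ≢ B) (same-Cor : ∀ k → Cor A A k ⇔ Cor B B k) (n : ℕ) where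

  K : ℕ
  K = suc n

  M : ℕ
  M = suc (length (allSeqs n))

  w : Bool → ℕ
  w true = length (allSeqs n)
  w false = M ^ K ∸ 1

  W W' : Bool → List Letter
  W true = toList A
  W false = toList B
  W' true = toList B
  W' false = toList A

  |W|≡1+ℓ' : ∀ x → length (W x) ≡ suc ℓ'
  |W|≡1+ℓ' true = Vec.length-toList A
  |W|≡1+ℓ' false = Vec.length-toList B

  |W'|≡1+ℓ' : ∀ x → length (W' x) ≡ suc ℓ'
  |W'|≡1+ℓ' true = Vec.length-toList B
  |W'|≡1+ℓ' false = Vec.length-toList A

  A≢B-lists : toList A ≢ toList B
  A≢B-lists e = A≢B (trans (sym (Vec.cast-is-id refl A)) (Vec.toList-injective refl A B e))

  module ByA = WeightedWords ℓ' W w |W|≡1+ℓ' A≢B-lists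
  module ByB = WeightedWords ℓ' W' w |W'|≡1+ℓ' (λ e → A≢B-lists (sym e))

  self-overlap-equal : ∀ j → j < ℓ' → ByB.κ true true j ≡ ByA.κ true true j
  self-overlap-equal j j<ℓ' = binary-≡ ([≼]-binary (take (ℓ' ∸ j) (toList B)) (drop (suc j) (toList B)))
                                        ([≼]-binary (take (ℓ' ∸ j) (toList A)) (drop (suc j) (toList A)))
    (⇔-sym (self-overlap⇔Cor A j j<ℓ') ⇔-∘ (⇔-sym (same-Cor (ℓ' ∸ j)) ⇔-∘ self-overlap⇔Cor B j j<ℓ'))

  κ-transposed : ∀ x y j → j < ℓ' → ByB.κ x y j ≡ ByA.κ y x j
  κ-transposed true true j j<ℓ' = self-overlap-equal j j<ℓ'
  κ-transposed true false j _ = refl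
  κ-transposed false true j _ = refl
  κ-transposed false false j j<ℓ' = sym (self-overlap-equal j j<ℓ')

  1+w-false≡M^K : suc (w false) ≡ M ^ K
  1+w-false≡M^K = trans (+-comm 1 (w false)) (m∸n+n≡m (m^n>0 M K))

  weight-as-power : ∀ p q → suc (w true) ^ p * suc (w false) ^ q ≡ M ^ (p + q * K)
  weight-as-power p q = begin
    M ^ p * suc (w false) ^ q   ≡⟨ cong (λ b → M ^ p * b ^ q) 1+w-false≡M^K ⟩
    M ^ p * (M ^ K) ^ q         ≡⟨ cong (M ^ p *_) (^-*-assoc M K q) ⟩
    M ^ p * M ^ (K * q)         ≡⟨ cong (λ e → M ^ p * M ^ e) (*-comm K q) ⟩
    M ^ p * M ^ (q * K)         ≡⟨ ^-distribˡ-+-* M p (q * K) ⟨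
    M ^ (p + q * K)             ∎
    where open ≡-Reasoning

  ∑-encoded : ∀ (C D : Word (suc ℓ')) →
    ∑ (allSeqs n) (λ X → M ^ (N C X + N D X * K)) ≡ ∑ (words n) (λ Z → M ^ (occurrences (toList C) Z + occurrences (toList D) Z * K))
  ∑-encoded C D = trans (∑-cong (allSeqs n) (λ X → cong₂ (λ p q → M ^ (p + q * K)) (N≡occurrences C X) (N≡occurrences D X)))
                        (∑-allSeqs n (λ Z → M ^ (occurrences (toList C) Z + occurrences (toList D) Z * K)))

  power-sums-symmetric : ∑ (allSeqs n) (λ X → M ^ (N A X + N B X * K)) ≡ ∑ (allSeqs n) (λ X → M ^ (N B X + N A X * K))
  power-sums-symmetric = begin
      ∑ (allSeqs n) (λ X → M ^ (N A X + N B X * K))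
    ≡⟨ ∑-encoded A B ⟩
      ∑ (words n) (λ Z → M ^ (occurrences (toList A) Z + occurrences (toList B) Z * K))
    ≡⟨ ∑-cong (words n) (λ Z → weight-as-power (occurrences (toList A) Z) (occurrences (toList B) Z)) ⟨
      ByA.f n
    ≡⟨ TransposedSystems.systems-agree ℓ' w ByA.system ByB.system κ-transposed n ⟩
      ByB.f n
    ≡⟨ ∑-cong (words n) (λ Z → weight-as-power (occurrences (toList B) Z) (occurrences (toList A) Z)) ⟩
      ∑ (words n) (λ Z → M ^ (occurrences (toList B) Z + occurrences (toList A) Z * K))
    ≡⟨ ∑-encoded B A ⟨
      ∑ (allSeqs n) (λ X → M ^ (N B X + N A X * K))
    ∎
    where open ≡-Reasoning

  N<K : ∀ (C : Word (suc ℓ')) X → N C X < K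
  N<K C X = s≤s (begin
    N C X                                   ≡⟨ N≡occurrences C X ⟩
    occurrences (toList C) (toList X)       ≤⟨ occurrences-≤-length (toList C) (toList X) ⟩
    length (toList X)                       ≡⟨ Vec.length-toList X ⟩
    n                                       ∎)
    where open ≤-Reasoning

  encoding-bound : ∀ (C D : Word (suc ℓ')) X → N C X + N D X * K < suc (n + n * K)
  encoding-bound C D X = s≤s (+-mono-≤ (s≤s⁻¹ (N<K C X)) (*-monoˡ-≤ K (s≤s⁻¹ (N<K D X))))

  decode : ∀ p q → p < K → (p + q * K) % K ≡ p × (p + q * K) / K ≡ q
  decode p q p<K = trans ([m+kn]%n≡m%n p q K) (m<n⇒m%n≡m p<K) ,
                   trans (+-distrib-/-∣ʳ p (divides q refl)) (cong₂ _+_ (m<n⇒m/n≡0 p<K) (m*n/n≡m q K))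

  joint-symmetric : ∀ (R : ℕ → ℕ → ℕ) → ∑ (allSeqs n) (λ X → R (N A X) (N B X)) ≡ ∑ (allSeqs n) (λ X → R (N B X) (N A X))
  joint-symmetric R = begin
      ∑ (allSeqs n) (λ X → R (N A X) (N B X))
    ≡⟨ ∑-cong (allSeqs n) (λ X → decoded (N A X) (N B X) (N<K A X)) ⟨
      ∑ (allSeqs n) (λ X → R' (N A X + N B X * K))
    ≡⟨ power-sums-determine-sums (allSeqs n) (λ X → N A X + N B X * K) (λ X → N B X + N A X * K)
         (length (allSeqs n)) (suc (n + n * K)) ≤-refl (encoding-bound A B) (encoding-bound B A) power-sums-symmetric R' ⟩
      ∑ (allSeqs n) (λ X → R' (N B X + N A X * K))
    ≡⟨ ∑-cong (allSeqs n) (λ X → decoded (N B X) (N A X) (N<K B X)) ⟩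
      ∑ (allSeqs n) (λ X → R (N B X) (N A X))
    ∎
    where
    open ≡-Reasoning
    R' : ℕ → ℕ
    R' e = R (e % K) (e / K)
    decoded : ∀ p q → p < K → R' (p + q * K) ≡ R p q
    decoded p q p<K = cong₂ R (proj₁ (decode p q p<K)) (proj₂ (decode p q p<K))

joint-distribution-symmetric : ∀ {ℓ'} (A B : Word (suc ℓ')) → (∀ k → Cor A A k ⇔ Cor B B k) → ∀ n (R : ℕ → ℕ → ℕ) →
  ∑ (allSeqs n) (λ X → R (N A X) (N B X)) ≡ ∑ (allSeqs n) (λ X → R (N B X) (N A X))
joint-distribution-symmetric A B same-Cor n R with Vec.≡-dec _≟L_ A B
... | yes refl = refl
... | no A≢B = Symmetry.joint-symmetric A B A≢B same-Cor n R

theorem1 : (ℓ : ℕ) → 1 ≤ ℓ → (A B : Word ℓ) →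
    ((k : ℕ) → Cor A A k ⇔ Cor B B k) →
    (n : ℕ) → 1 ≤ n →
    ((i j : ℕ) → countPair n A B i j ≡ countPair n B A i j)
    × (countGreater n A B ≡ countGreater n B A)
theorem1 (suc ℓ') _ A B same-Cor n _ =
  (λ i j → counts-symmetric (λ p q → (p ≟ i) ×-dec (q ≟ j))) , counts-symmetric (λ p q → suc p ≤? q)
  where
  counts-symmetric : ∀ {P : ℕ → ℕ → Set} (P? : ∀ p q → Dec (P p q)) →
    length (filter (λ X → P? (N A X) (N B X)) (allSeqs n)) ≡ length (filter (λ X → P? (N B X) (N A X)) (allSeqs n))
  counts-symmetric P? = trans (length-filter-∑ _ (allSeqs n))
    (trans (joint-distribution-symmetric A B same-Cor n (λ p q → 𝟙 (P? p q))) (sym (length-filter-∑ _ (allSeqs n))))
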